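{- Let $G$ be a caterpillar. Then $\rho_T(G)\le 2$.
   Context: Graphs are finite and simple. A tree is a connected graph with no cycles. A caterpillar is a tree containing a single path that contains at least one endpoint of every edge. For $u,v\in(\mathbb{R}\cup\{\infty\})^k$, $u\odot v=\min_i(u_i+v_i)$. $\rho_T(G)$ is the minimum $k$ such that there is $f:V(G)\to(\mathbb{R}\cup\{\infty\})^k$ and a threshold $t>0$ with, for all distinct $x,y$, $xy\in E(G)$ iff $f(x)\odot f(y)\ge t$. -}

module Defs where

open import Level using (0ℓ)
open import Data.Nat using (ℕ; _≥_)
open import Data.Fin using (Fin)
open import Data.List using (List; []; _∷_; length)
open import Data.List.Membership.Propositional using (_∈_)
open import Data.List.Relation.Unary.Unique.Propositional using (Unique)
open import Data.Vec using (Vec; foldr; zipWith)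
open import Data.Rational using (ℚ; 0ℚ; _<_; _≤_) renaming (_+_ to _+ℚ_; _⊓_ to _⊓ℚ_)
open import Data.Product using (Σ; ∃; _×_; _,_)
open import Data.Sum using (_⊎_)
open import Relation.Binary.PropositionalEquality using (_≡_; _≢_)
open import Relation.Nullary using (¬_)

record Graph (n : ℕ) : Set₁ where
  field
    Adj    : Fin n → Fin n → Set
    sym    : ∀ {x y} → Adj x y → Adj y x
    irrefl : ∀ {x} → ¬ Adj x x

module _ {n : ℕ} (G : Graph n) where
  open Graph G

  data Chain : List (Fin n) → Set where
    nil  : Chain []
    one  : ∀ x → Chain (x ∷ [])
    cons : ∀ {x y xs} → Adj x y → Chain (y ∷ xs) → Chain (x ∷ y ∷ xs)

  lastOf : Fin n → List (Fin n) → Fin n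
  lastOf x []       = x
  lastOf x (y ∷ ys) = lastOf y ys

  IsPath : List (Fin n) → Set
  IsPath p = Unique p × Chain p

  PathFromTo : Fin n → Fin n → List (Fin n) → Set
  PathFromTo x y []       = Data.Empty.⊥ where import Data.Empty
  PathFromTo x y (z ∷ zs) = (z ≡ x) × (lastOf z zs ≡ y) × IsPath (z ∷ zs)

  Connected : Set
  Connected = ∀ x y → ∃ λ p → PathFromTo x y p

  IsCycle : List (Fin n) → Set
  IsCycle []       = Data.Empty.⊥ where import Data.Empty
  IsCycle (v ∷ vs) = (length (v ∷ vs) ≥ 3) × IsPath (v ∷ vs) × Adj (lastOf v vs) v

  Acyclic : Set
  Acyclic = ∀ c → ¬ IsCycle c

  IsTree : Set
  IsTree = Connected × Acyclic

  IsCaterpillar : Set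
  IsCaterpillar = IsTree × ∃ λ P → IsPath P × (∀ x y → Adj x y → (x ∈ P) ⊎ (y ∈ P))

data ℚ∞ : Set where
  fin : ℚ → ℚ∞
  ∞   : ℚ∞

_+∞_ : ℚ∞ → ℚ∞ → ℚ∞
fin a +∞ fin b = fin (a +ℚ b)
fin a +∞ ∞     = ∞
∞     +∞ _     = ∞

_⊓∞_ : ℚ∞ → ℚ∞ → ℚ∞
fin a ⊓∞ fin b = fin (a ⊓ℚ b)
fin a ⊓∞ ∞     = fin a
∞     ⊓∞ b     = b

data _≤∞_ (t : ℚ) : ℚ∞ → Set where
  fin≤ : ∀ {a} → t ≤ a → t ≤∞ fin a
  ≤inf : t ≤∞ ∞

_⊙_ : ∀ {k} → Vec ℚ∞ k → Vec ℚ∞ k → ℚ∞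
u ⊙ v = foldr (λ _ → ℚ∞) _⊓∞_ ∞ (zipWith _+∞_ u v)

ThresholdRep : ∀ {n} → Graph n → ℕ → Set
ThresholdRep {n} G k =
  Σ (Fin n → Vec ℚ∞ k) λ f → Σ ℚ λ t → (0ℚ < t) ×
    (∀ x y → x ≢ y → (Graph.Adj G x y → t ≤∞ (f x ⊙ f y)) × (t ≤∞ (f x ⊙ f y) → Graph.Adj G x y))

ρT≤ : ∀ {n} → Graph n → ℕ → Set
ρT≤ G m = ∃ λ k → (k Data.Nat.≤ m) × ThresholdRep G k

-- A caterpillar is an interval bigraph: colour the spine v₀ … vₖ alternately,
-- give vᵢ the interval [i, i + 2), and give every other vertex, which hangs off a
-- unique spine vertex vᵢ, the opposite colour of vᵢ and the interval [i, i + 1).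
-- Acyclicity is what makes this exact: a chord of the spine, or a vertex off the
-- spine with two spine neighbours, would close a cycle. An interval bigraph has
-- threshold dimension 2: with threshold 1, a vertex with interval [lo, hi) gets
-- the point (1 + hi, -1 - lo) on one side and (-1 - lo, 1 + hi) on the other.
module Submission where

open import Defs
open import Data.Nat using (ℕ)

open import Level using (Level)
open import Data.Bool using (Bool; true; false; not)
open import Data.Bool.Properties using (not-¬; not-involutive)
open import Data.Empty using (⊥-elim)
open import Data.Fin using (Fin; _≟_)
open import Data.Integer as ℤ using (ℤ; +[1+_]; -[1+_]; 1ℤ; _⊖_)
import Data.Integer.Properties as ℤ
open import Data.List using (List; []; _∷_; length)
open import Data.List.Membership.Propositional using (_∈_; _∉_)
open import Data.List.Relation.Binary.Subset.Propositional using (_⊆_)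
open import Data.List.Relation.Binary.Subset.Propositional.Properties using (⊆-trans; xs⊆x∷xs; ∷⁺ʳ)
open import Data.List.Relation.Unary.All using ([]; _∷_)
open import Data.List.Relation.Unary.All.Properties using (anti-mono; ¬Any⇒All¬)
open import Data.List.Relation.Unary.AllPairs using ([]; _∷_)
import Data.List.Relation.Unary.Any as Any
open import Data.Nat as ℕ using (suc; zero; _≤_; _<_; z≤n; s≤s; z<s; s<s; s<s⁻¹)
open import Data.Nat.Properties as ℕ using (<-cmp; ≤-antisym; m<1+n⇒m≤n; m≤n⇒m<n∨m≡n; n<1+n; n≤1+n; m≤n+m; <⇒≤; +-cancelʳ-≤; +-suc)
import Data.Nat.Coprimality as Coprime
open import Data.Product using (Σ; ∃; _×_; _,_; proj₁; proj₂)
open import Data.Product.Function.NonDependent.Propositional using (_×-⇔_)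
open import Data.Rational as ℚ using (ℚ; mkℚ; _+_; *≤*)
import Data.Rational.Properties as ℚ
import Data.Rational.Unnormalised as ℚᵘ
import Data.Rational.Unnormalised.Properties as ℚᵘ
open import Data.Sum using (_⊎_; inj₁; inj₂; [_,_]′)
open import Data.Vec using (Vec; []; _∷_)
open import Function using (_∘_)
open import Function.Bundles using (_⇔_; mk⇔; Equivalence)
open import Function.Properties.Equivalence using () renaming (trans to ⇔-trans; sym to ⇔-sym)
open import Relation.Binary using (tri<; tri≈; tri>)
open import Relation.Binary.PropositionalEquality using (_≡_; _≢_; refl; sym; trans; cong; cong₂; subst; subst₂; ≢-sym)
open import Relation.Nullary using (¬_; yes; no; contradiction)

private
  variable
    a : Level
    A : Set a
    i j : ℕ
    x y : A
    xs : List A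

data _[_]=_ {A : Set a} : List A → ℕ → A → Set a where
  here  : (x ∷ xs) [ 0 ]= x
  there : xs [ i ]= x → (y ∷ xs) [ suc i ]= x

[]=-functional : xs [ i ]= x → xs [ i ]= y → x ≡ y
[]=-functional here      here      = refl
[]=-functional (there p) (there q) = []=-functional p q

∈⇒[]= : x ∈ xs → ∃ (xs [_]= x)
∈⇒[]= (Any.here refl) = 0 , here
∈⇒[]= (Any.there x∈xs) with ∈⇒[]= x∈xs
... | i , p = suc i , there p

Consecutive : ℕ → ℕ → Set
Consecutive i j = suc i ≡ j ⊎ suc j ≡ i

near⇒consecutive : i ≤ suc j → j ≤ suc i → i ≢ j → Consecutive i j
near⇒consecutive {i} {j} i≤1+j j≤1+i i≢j with <-cmp i j
... | tri< i<j _ _ = inj₁ (≤-antisym i<j j≤1+i)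
... | tri≈ _ i≡j _ = contradiction i≡j i≢j
... | tri> _ _ j<i = inj₂ (≤-antisym j<i i≤1+j)

parity : ℕ → Bool
parity zero    = false
parity (suc n) = not (parity n)

record Label : Set where
  constructor label
  field
    side : Bool
    lo hi : ℕ

open Label

Meets : Label → Label → Set
Meets a b = side a ≢ side b × lo a < hi b × lo b < hi a

Meets-sym : ∀ {a b} → Meets a b → Meets b a
Meets-sym (sides , ab , ba) = ≢-sym sides , ba , ab

IntervalBigraph : ∀ {n} → Graph n → Set
IntervalBigraph {n} G = Σ (Fin n → Label) λ ℓ → ∀ x y → x ≢ y → Graph.Adj G x y ⇔ Meets (ℓ x) (ℓ y)

ι : ℤ → ℚ
ι z = mkℚ z 0 (Coprime.sym (Coprime.1-coprimeTo _))

ι-mono-≤ : ∀ {c d} → c ℤ.≤ d → ι c ℚ.≤ ι d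
ι-mono-≤ {c} {d} c≤d = *≤* (subst₂ ℤ._≤_ (sym (ℤ.*-identityʳ c)) (sym (ℤ.*-identityʳ d)) c≤d)

ι-cancel-≤ : ∀ {c d} → ι c ℚ.≤ ι d → c ℤ.≤ d
ι-cancel-≤ {c} {d} (*≤* c≤d) = subst₂ ℤ._≤_ (ℤ.*-identityʳ c) (ℤ.*-identityʳ d) c≤d

ι-homo-+ : ∀ c d → ι (c ℤ.+ d) ≡ ι c + ι d
ι-homo-+ c d = ℚ.toℚᵘ-injective (ℚᵘ.≃-trans (ℚᵘ.*≡* numerators) (ℚᵘ.≃-sym (ℚ.toℚᵘ-homo-+ (ι c) (ι d))))
  where
  numerators : (c ℤ.+ d) ℤ.* 1ℤ ≡ (c ℤ.* 1ℤ ℤ.+ d ℤ.* 1ℤ) ℤ.* 1ℤ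
  numerators = cong (ℤ._* 1ℤ) (sym (cong₂ ℤ._+_ (ℤ.*-identityʳ c) (ℤ.*-identityʳ d)))

ι1≤ι+ι⇔1≤+ : ∀ c d → ι 1ℤ ℚ.≤ ι c + ι d ⇔ 1ℤ ℤ.≤ c ℤ.+ d
ι1≤ι+ι⇔1≤+ c d = mk⇔
  (λ le → ι-cancel-≤ (subst (ι 1ℤ ℚ.≤_) (sym (ι-homo-+ c d)) le))
  (λ le → subst (ι 1ℤ ℚ.≤_) (ι-homo-+ c d) (ι-mono-≤ le))

1≤m⊖n⇒n<m : ∀ m n → 1ℤ ℤ.≤ m ⊖ n → n < m
1≤m⊖n⇒n<m zero    zero    (ℤ.+≤+ ())
1≤m⊖n⇒n<m zero    (suc n) ()
1≤m⊖n⇒n<m (suc m) zero    _  = z<s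
1≤m⊖n⇒n<m (suc m) (suc n) le =
  s<s (1≤m⊖n⇒n<m m n (subst (1ℤ ℤ.≤_) (ℤ.[1+m]⊖[1+n]≡m⊖n m n) le))

n<m⇒1≤m⊖n : ∀ m n → n < m → 1ℤ ℤ.≤ m ⊖ n
n<m⇒1≤m⊖n (suc m) zero    _         = ℤ.+≤+ z<s
n<m⇒1≤m⊖n (suc m) (suc n) (s<s n<m) =
  subst (1ℤ ℤ.≤_) (sym (ℤ.[1+m]⊖[1+n]≡m⊖n m n)) (n<m⇒1≤m⊖n m n n<m)

1≤[1+m]⊖[1+n]⇔n<m : ∀ m n → 1ℤ ℤ.≤ suc m ⊖ suc n ⇔ n < m
1≤[1+m]⊖[1+n]⇔n<m m n = mk⇔ (s<s⁻¹ ∘ 1≤m⊖n⇒n<m (suc m) (suc n)) (n<m⇒1≤m⊖n (suc m) (suc n) ∘ s<s)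

≤∞-⊙₂ : ∀ {t} p q p′ q′ → t ≤∞ ((fin p ∷ fin q ∷ []) ⊙ (fin p′ ∷ fin q′ ∷ [])) ⇔ (t ℚ.≤ p + p′ × t ℚ.≤ q + q′)
≤∞-⊙₂ p q p′ q′ = mk⇔
  (λ { (fin≤ le) → ℚ.p≤q⊓r⇒p≤q (p + p′) (q + q′) le , ℚ.p≤q⊓r⇒p≤r (p + p′) (q + q′) le })
  (λ (le₁ , le₂) → fin≤ (ℚ.⊓-glb le₁ le₂))

-- On opposite sides a coordinate sum is (1 + hi) ⊖ (1 + lo′), which is ≥ 1 iff
-- lo′ < hi; on equal sides one coordinate sum adds two negative entries.
coord₁ coord₂ : Label → ℤ
coord₁ (label false lo hi) = +[1+ hi ]
coord₁ (label true  lo hi) = -[1+ lo ]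
coord₂ (label false lo hi) = -[1+ lo ]
coord₂ (label true  lo hi) = +[1+ hi ]

point : Label → Vec ℚ∞ 2
point a = fin (ι (coord₁ a)) ∷ fin (ι (coord₂ a)) ∷ []

CoordSums≥1 : Label → Label → Set
CoordSums≥1 a b = 1ℤ ℤ.≤ coord₁ a ℤ.+ coord₁ b × 1ℤ ℤ.≤ coord₂ a ℤ.+ coord₂ b

point-⊙⇔CoordSums≥1 : ∀ a b → ι 1ℤ ≤∞ (point a ⊙ point b) ⇔ CoordSums≥1 a b
point-⊙⇔CoordSums≥1 a b = ⇔-trans (≤∞-⊙₂ (ι (coord₁ a)) (ι (coord₂ a)) (ι (coord₁ b)) (ι (coord₂ b)))
  (ι1≤ι+ι⇔1≤+ (coord₁ a) (coord₁ b) ×-⇔ ι1≤ι+ι⇔1≤+ (coord₂ a) (coord₂ b))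

CoordSums≥1⇔Meets : ∀ a b → CoordSums≥1 a b ⇔ Meets a b
CoordSums≥1⇔Meets (label false lo hi) (label false lo′ hi′) =
  mk⇔ (λ { (_ , ()) }) (λ (sides , _) → contradiction refl sides)
CoordSums≥1⇔Meets (label false lo hi) (label true lo′ hi′) =
  ⇔-trans (1≤[1+m]⊖[1+n]⇔n<m hi lo′ ×-⇔ 1≤[1+m]⊖[1+n]⇔n<m hi′ lo)
    (mk⇔ (λ (lo′<hi , lo<hi′) → (λ ()) , lo<hi′ , lo′<hi) (λ (_ , lo<hi′ , lo′<hi) → lo′<hi , lo<hi′))
CoordSums≥1⇔Meets (label true lo hi) (label false lo′ hi′) =
  ⇔-trans (1≤[1+m]⊖[1+n]⇔n<m hi′ lo ×-⇔ 1≤[1+m]⊖[1+n]⇔n<m hi lo′)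
    (mk⇔ (λ lo<hi′×lo′<hi → (λ ()) , lo<hi′×lo′<hi) proj₂)
CoordSums≥1⇔Meets (label true lo hi) (label true lo′ hi′) =
  mk⇔ (λ { (() , _) }) (λ (sides , _) → contradiction refl sides)

point-⊙⇔Meets : ∀ a b → ι 1ℤ ≤∞ (point a ⊙ point b) ⇔ Meets a b
point-⊙⇔Meets a b = ⇔-trans (point-⊙⇔CoordSums≥1 a b) (CoordSums≥1⇔Meets a b)

intervalBigraph⇒ρT≤2 : ∀ {n} (G : Graph n) → IntervalBigraph G → ρT≤ G 2
intervalBigraph⇒ρT≤2 G (ℓ , rep) =
  2 , ℕ.≤-refl , point ∘ ℓ , ι 1ℤ , ℚ.positive⁻¹ (ι 1ℤ) , λ x y x≢y →
    let adj⇔ = ⇔-trans (rep x y x≢y) (⇔-sym (point-⊙⇔Meets (ℓ x) (ℓ y)))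
    in Equivalence.to adj⇔ , Equivalence.from adj⇔

module _ {n} (G : Graph n) where
  open Graph G renaming (sym to Adj-sym)

  private
    variable
      u v w : Fin n
      P : List (Fin n)

  IsPath-tail : IsPath G (u ∷ P) → IsPath G P
  IsPath-tail (_ ∷ unique , one _)        = unique , nil
  IsPath-tail (_ ∷ unique , cons _ chain) = unique , chain

  record Segment (P : List (Fin n)) (u v : Fin n) (i j : ℕ) : Set where
    field
      after      : List (Fin n)
      isPath     : IsPath G (u ∷ after)
      ends       : lastOf G u after ≡ v
      length+i≡j : length after ℕ.+ i ≡ j
      ⊆P         : u ∷ after ⊆ P

  segment : IsPath G P → P [ i ]= u → P [ j ]= v → i ≤ j → Segment P u v i j
  segment _ here here _ = record
    { after = [] ; isPath = [] ∷ [] , one _ ; ends = refl ; length+i≡j = refl ; ⊆P = ∷⁺ʳ _ (λ ()) }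
  segment (u∉rest ∷ unique , cons uw chain) here (there q) _ = record
    { after      = _ ∷ after
    ; isPath     = anti-mono ⊆P u∉rest ∷ proj₁ isPath , cons uw (proj₂ isPath)
    ; ends       = ends
    ; length+i≡j = cong suc length+i≡j
    ; ⊆P         = ∷⁺ʳ _ ⊆P
    }
    where open Segment (segment (unique , chain) here q z≤n)
  segment path (there p) (there q) (s≤s i≤j) = record
    { after      = after
    ; isPath     = isPath
    ; ends       = ends
    ; length+i≡j = trans (+-suc _ _) (cong suc length+i≡j)
    ; ⊆P         = ⊆-trans ⊆P (xs⊆x∷xs _ _)
    }
    where open Segment (segment (IsPath-tail path) p q i≤j)

  module _ (acyclic : Acyclic G) (path : IsPath G P) where

    no-chord : P [ i ]= u → P [ j ]= v → suc i < j → ¬ Adj u v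
    no-chord {i} {u = u} p q 2+i≤j uv = acyclic (u ∷ after)
      ( s≤s (+-cancelʳ-≤ i 2 _ (subst (2 ℕ.+ i ≤_) (sym length+i≡j) 2+i≤j))
      , isPath
      , subst (λ z → Adj z u) (sym ends) (Adj-sym uv) )
      where open Segment (segment path p q (<⇒≤ (ℕ.<-trans (n<1+n i) 2+i≤j)))

    no-detour : w ∉ P → Adj w u → Adj w v → P [ i ]= u → P [ j ]= v → ¬ i < j
    no-detour {w} {u} {i = i} w∉P wu wv p q i<j = acyclic (w ∷ u ∷ after)
      ( s≤s (s≤s (+-cancelʳ-≤ i 1 _ (subst (suc i ≤_) (sym length+i≡j) i<j)))
      , (¬Any⇒All¬ _ (w∉P ∘ ⊆P) ∷ proj₁ isPath , cons wu (proj₂ isPath))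
      , subst (λ z → Adj z w) (sym ends) (Adj-sym wv) )
      where open Segment (segment path p q (<⇒≤ i<j))

    adjacent⇒consecutive : P [ i ]= u → P [ j ]= v → Adj u v → Consecutive i j
    adjacent⇒consecutive {i} {j = j} p q uv with <-cmp i j
    ... | tri≈ _ refl _ = contradiction (subst (Adj _) (sym ([]=-functional p q)) uv) irrefl
    ... | tri< i<j _ _ with m≤n⇒m<n∨m≡n i<j
    ...   | inj₁ 1+i<j  = contradiction uv (no-chord p q 1+i<j)
    ...   | inj₂ 1+i≡j  = inj₁ 1+i≡j
    adjacent⇒consecutive {i} {j = j} p q uv | tri> _ _ j<i with m≤n⇒m<n∨m≡n j<i
    ...   | inj₁ 1+j<i  = contradiction (Adj-sym uv) (no-chord q p 1+j<i)
    ...   | inj₂ 1+j≡i  = inj₂ 1+j≡i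

    off-path-neighbours-at-same-index : w ∉ P → Adj w u → Adj w v → P [ i ]= u → P [ j ]= v → i ≡ j
    off-path-neighbours-at-same-index {i = i} {j} w∉P wu wv p q with <-cmp i j
    ... | tri< i<j _ _ = contradiction i<j (no-detour w∉P wu wv p q)
    ... | tri≈ _ i≡j _ = i≡j
    ... | tri> _ _ j<i = contradiction j<i (no-detour w∉P wv wu q p)

  consecutive⇒adjacent : Chain G P → P [ i ]= u → P [ j ]= v → Consecutive i j → Adj u v
  consecutive⇒adjacent (one _)        here      (there ())   (inj₁ refl)
  consecutive⇒adjacent (cons uv _)    here      (there here) (inj₁ refl) = uv
  consecutive⇒adjacent (cons _ chain) (there p) (there q)    (inj₁ refl) = consecutive⇒adjacent chain p q (inj₁ refl)
  consecutive⇒adjacent chain p q (inj₂ refl) = Adj-sym (consecutive⇒adjacent chain q p (inj₁ refl))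

spineLabel leafLabel : ℕ → Label
spineLabel i = label (parity i) i (2 ℕ.+ i)
leafLabel  i = label (not (parity i)) i (suc i)

consecutive⇒spineLabels-Meet : Consecutive i j → Meets (spineLabel i) (spineLabel j)
consecutive⇒spineLabels-Meet {i} (inj₁ refl) = not-¬ refl , m≤n+m (suc i) 2 , n<1+n (suc i)
consecutive⇒spineLabels-Meet     (inj₂ refl) = Meets-sym (consecutive⇒spineLabels-Meet (inj₁ refl))

spineLabels-Meet⇔consecutive : i ≢ j → Meets (spineLabel i) (spineLabel j) ⇔ Consecutive i j
spineLabels-Meet⇔consecutive i≢j = mk⇔
  (λ (_ , i<2+j , j<2+i) → near⇒consecutive (m<1+n⇒m≤n i<2+j) (m<1+n⇒m≤n j<2+i) i≢j)
  consecutive⇒spineLabels-Meet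

spineLeafLabels-Meet⇒≡ : Meets (spineLabel i) (leafLabel j) → i ≡ j
spineLeafLabels-Meet⇒≡ {i} (sides , i<1+j , j<2+i) with m≤n⇒m<n∨m≡n (m<1+n⇒m≤n i<1+j)
... | inj₂ i≡j = i≡j
... | inj₁ i<j with ≤-antisym i<j (m<1+n⇒m≤n j<2+i)
...   | refl = contradiction (sym (not-involutive (parity i))) sides

spineLeafLabels-Meet⇔≡ : Meets (spineLabel i) (leafLabel j) ⇔ i ≡ j
spineLeafLabels-Meet⇔≡ = mk⇔ spineLeafLabels-Meet⇒≡ λ { refl → not-¬ refl , n<1+n _ , n≤1+n _ }

leafLabels-¬Meet : ¬ Meets (leafLabel i) (leafLabel j)
leafLabels-¬Meet (sides , i<1+j , j<1+i) =
  sides (cong (not ∘ parity) (≤-antisym (m<1+n⇒m≤n i<1+j) (m<1+n⇒m≤n j<1+i)))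

VertexCover : ∀ {n} → Graph n → List (Fin n) → Set
VertexCover G P = ∀ x y → Graph.Adj G x y → x ∈ P ⊎ y ∈ P

module _ {n} {G : Graph n} {P : List (Fin n)} where
  open Graph G renaming (sym to Adj-sym)
  open import Data.List.Membership.DecPropositional (_≟_ {n}) using (_∈?_)

  private
    variable
      u v w : Fin n

  data Position (v : Fin n) : Set where
    spine : P [ i ]= v → Position v
    leaf  : v ∉ P → Adj v w → P [ i ]= w → Position v

  positionLabel : Position v → Label
  positionLabel (spine {i} _)        = spineLabel i
  positionLabel (leaf {i = i} _ _ _) = leafLabel i

  neighbour : Connected G → u ≢ v → ∃ (Adj u)
  neighbour {u} {v} connected u≢v with connected u v
  ... | _ ∷ []    , refl , refl , _ = contradiction refl u≢v
  ... | _ ∷ w ∷ _ , refl , _ , _ , cons uw _ = w , uw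

  position : Connected G → VertexCover G P → u ∈ P → ∀ v → Position v
  position {u} connected cover u∈P v with v ∈? P
  ... | yes v∈P = spine (proj₂ (∈⇒[]= v∈P))
  ... | no v∉P with neighbour connected (λ v≡u → v∉P (subst (_∈ P) (sym v≡u) u∈P))
  ...   | w , vw with cover v w vw
  ...     | inj₁ v∈P = contradiction v∈P v∉P
  ...     | inj₂ w∈P = leaf v∉P vw (proj₂ (∈⇒[]= w∈P))

  module _ (acyclic : Acyclic G) (path : IsPath G P) (cover : VertexCover G P) where

    spine-leaf-adjacent⇔Meet : P [ i ]= u → v ∉ P → Adj v w → P [ j ]= w →
                               Adj u v ⇔ Meets (spineLabel i) (leafLabel j)
    spine-leaf-adjacent⇔Meet p v∉P vw q = ⇔-trans
      (mk⇔ (λ uv → off-path-neighbours-at-same-index G acyclic path v∉P (Adj-sym uv) vw p q)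
           (λ { refl → Adj-sym (subst (Adj _) ([]=-functional q p) vw) }))
      (⇔-sym spineLeafLabels-Meet⇔≡)

    adjacent⇔positionLabels-Meet : u ≢ v → (pu : Position u) (pv : Position v) →
                                   Adj u v ⇔ Meets (positionLabel pu) (positionLabel pv)
    adjacent⇔positionLabels-Meet u≢v (spine p) (spine q) = ⇔-trans
      (mk⇔ (adjacent⇒consecutive G acyclic path p q) (consecutive⇒adjacent G (proj₂ path) p q))
      (⇔-sym (spineLabels-Meet⇔consecutive λ { refl → u≢v ([]=-functional p q) }))
    adjacent⇔positionLabels-Meet _ (spine p) (leaf v∉P vw q) = spine-leaf-adjacent⇔Meet p v∉P vw q
    adjacent⇔positionLabels-Meet _ (leaf u∉P uw p) (spine q) = ⇔-trans (mk⇔ Adj-sym Adj-sym)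
      (⇔-trans (spine-leaf-adjacent⇔Meet q u∉P uw p) (mk⇔ Meets-sym Meets-sym))
    adjacent⇔positionLabels-Meet _ (leaf u∉P _ _) (leaf v∉P _ _) = mk⇔
      (λ uv → ⊥-elim ([ u∉P , v∉P ]′ (cover _ _ uv)))
      (⊥-elim ∘ leafLabels-¬Meet)

edgeless⇒intervalBigraph : ∀ {n} (G : Graph n) → (∀ x y → ¬ Graph.Adj G x y) → IntervalBigraph G
edgeless⇒intervalBigraph G edgeless =
  (λ _ → label false 0 0) , λ x y _ → mk⇔ (⊥-elim ∘ edgeless x y) (λ (sides , _) → contradiction refl sides)

caterpillar⇒intervalBigraph : ∀ {n} (G : Graph n) → IsCaterpillar G → IntervalBigraph G
caterpillar⇒intervalBigraph G (_ , [] , _ , cover) =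
  edgeless⇒intervalBigraph G λ x y xy → [ (λ ()) , (λ ()) ]′ (cover x y xy)
caterpillar⇒intervalBigraph {n} G ((connected , acyclic) , p ∷ ps , path , cover) =
  positionLabel ∘ position′ , λ x y x≢y →
    adjacent⇔positionLabels-Meet acyclic path cover x≢y (position′ x) (position′ y)
  where
  position′ : (v : Fin n) → Position {G = G} {P = p ∷ ps} v
  position′ = position connected cover (Any.here refl)

mainTheorem19 : (n : ℕ) (G : Graph n) → IsCaterpillar G → ρT≤ G 2
mainTheorem19 n G = intervalBigraph⇒ρT≤2 G ∘ caterpillar⇒intervalBigraph G
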